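{- Let $w$ be a primitive word over $V$. Then $w$ is not ins-robust if and only if $w$ can be written as $w = u^{r} u_1 u_2 u^{s}$, where $u_1, u_2 \in V^*$, $c \in V$, $u = u_1 c u_2 \in Q$, $r, s \ge 0$ are integers and $r + s \ge 1$.
   Context: $V$ is a finite alphabet with at least two distinct letters; $V^*$ is the set of all finite words over $V$ (including the empty word $\lambda$), and $|w|$ denotes the length of $w$. A nonempty word $w$ is primitive if it is not of the form $v^n$ for a word $v$ and an integer $n \ge 2$; $Q$ denotes the set of primitive words over $V$. For a word $w$ of length $n$, $w[1..i]$ denotes its prefix of length $i$ (empty for $i=0$) and $w[i+1..n]$ its suffix of length $n-i$. A primitive word $w$ of length $n$ is called ins-robust if for every $i \in \{0,1,\ldots,n\}$ and every $a \in V$ the word $w[1..i]\,a\,w[i+1..n]$ is primitive. -}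

module Defs where

open import Data.Nat using (ℕ; zero; suc; _≤_; _+_)
open import Data.Fin using (Fin)
open import Data.List using (List; []; _∷_; _++_; length; take; drop)
open import Data.Product using (Σ; _×_; ∃-syntax)
open import Relation.Binary.PropositionalEquality using (_≡_; _≢_)
open import Relation.Nullary using (¬_)

Word : ℕ → Set
Word k = List (Fin k)

_^_ : ∀ {k} → Word k → ℕ → Word k
v ^ zero  = []
v ^ suc n = v ++ (v ^ n)

Primitive : ∀ {k} → Word k → Set
Primitive {k} w = (w ≢ []) × ¬ (Σ (Word k) λ v → Σ ℕ λ n → (2 ≤ n) × (w ≡ v ^ n))

insertAt : ∀ {k} → Word k → ℕ → Fin k → Word k
insertAt w i a = take i w ++ (a ∷ drop i w)

InsRobust : ∀ {k} → Word k → Set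
InsRobust {k} w = Primitive w × ((i : ℕ) → i ≤ length w → (a : Fin k) → Primitive (insertAt w i a))

-- Inserting c into w = u^r u₁ u₂ u^s right after u^r u₁ yields the proper power u^(r+1+s).
-- Conversely, if inserting a letter a gives a non-primitive word, that word is p^m with p
-- primitive and m ≥ 2; the inserted letter falls inside one copy p = u₁ a u₂, and removing it
-- leaves w = p^q u₁ u₂ p^s with q + s = m - 1 ≥ 1.
module Submission where

open import Defs
open import Data.Nat using (ℕ; zero; suc; _≤_; _<_; _+_; _*_; z≤n; s≤s)
open import Data.Nat.Properties using (≤-trans; ≤-reflexive; m≤n+m; m<m+n; +-suc; suc-injective; anyUpTo?)
open import Data.Nat.Induction using (<-wellFounded)
open import Data.Fin using (Fin)
open import Data.Fin.Properties using (any?) renaming (_≟_ to _≟ᶠ_)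
open import Data.List using ([]; _∷_; _++_; length; take; drop)
open import Data.List.Properties using (≡-dec; length-++; length-++-≤ˡ; length-++-≤ʳ; ++-assoc; ++-identityʳ; ++-conicalʳ; take++drop≡id; ∷-injective)
open import Data.Product using (Σ; ∃; _×_; _,_; proj₂)
open import Data.Sum using (_⊎_; inj₁; inj₂)
open import Data.Empty using (⊥-elim)
open import Function.Bundles using (_⇔_; mk⇔)
open import Induction.WellFounded using (Acc; acc)
open import Relation.Binary.PropositionalEquality using (_≡_; _≢_; refl; sym; trans; cong; cong₂; subst; module ≡-Reasoning)
open import Relation.Nullary using (¬_; Dec; yes; no; ¬?)
open import Relation.Nullary.Decidable using (map′; decidable-stable)

module _ {k : ℕ} where

  ProperPower : Word k → Set
  ProperPower w = Σ (Word k) λ v → Σ ℕ λ n → (2 ≤ n) × (w ≡ v ^ n)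

  ShortOfPower : Word k → Set
  ShortOfPower w = Σ (Word k) λ u₁ → Σ (Word k) λ u₂ → Σ (Fin k) λ c → Σ ℕ λ r → Σ ℕ λ s →
    Primitive (u₁ ++ (c ∷ u₂)) × (1 ≤ r + s) ×
    (w ≡ ((u₁ ++ (c ∷ u₂)) ^ r) ++ (u₁ ++ (u₂ ++ ((u₁ ++ (c ∷ u₂)) ^ s))))

  ^-+ : (v : Word k) (m n : ℕ) → v ^ (m + n) ≡ v ^ m ++ v ^ n
  ^-+ v zero    n = refl
  ^-+ v (suc m) n = trans (cong (v ++_) (^-+ v m n)) (sym (++-assoc v (v ^ m) (v ^ n)))

  ^-* : (v : Word k) (m n : ℕ) → (v ^ m) ^ n ≡ v ^ (n * m)
  ^-* v m zero    = refl
  ^-* v m (suc n) = trans (cong (v ^ m ++_) (^-* v m n)) (sym (^-+ v m (n * m)))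

  []^ : (n : ℕ) → [] {A = Fin k} ^ n ≡ []
  []^ zero    = refl
  []^ (suc n) = []^ n

  exponent≤length-^ : (b : Fin k) (v : Word k) (n : ℕ) → n ≤ length ((b ∷ v) ^ n)
  exponent≤length-^ b v zero    = z≤n
  exponent≤length-^ b v (suc n) =
    s≤s (≤-trans (exponent≤length-^ b v n) (length-++-≤ʳ ((b ∷ v) ^ n) {v}))

  length-<-^ : (b : Fin k) (v : Word k) (n : ℕ) → length (b ∷ v) < length ((b ∷ v) ^ (2 + n))
  length-<-^ b v n = subst (length (b ∷ v) <_) (sym (length-++ (b ∷ v)))
    (m<m+n (length (b ∷ v)) (s≤s z≤n))

  take-length-++ : (xs ys : Word k) → take (length xs) (xs ++ ys) ≡ xs
  take-length-++ []       ys = refl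
  take-length-++ (x ∷ xs) ys = cong (x ∷_) (take-length-++ xs ys)

  drop-length-++ : (xs ys : Word k) → drop (length xs) (xs ++ ys) ≡ ys
  drop-length-++ []       ys = refl
  drop-length-++ (x ∷ xs) ys = drop-length-++ xs ys

  insertAt-++ : (xs ys : Word k) (c : Fin k) → insertAt (xs ++ ys) (length xs) c ≡ xs ++ (c ∷ ys)
  insertAt-++ xs ys c = cong₂ (λ l r → l ++ (c ∷ r)) (take-length-++ xs ys) (drop-length-++ xs ys)

  -- A root of a proper power of w can be taken to be a prefix of w with both the
  -- prefix length and the exponent bounded by |w|; this makes the search finite.
  properPower-bounded : (w : Word k) → ProperPower w →
    ∃ λ d → d < suc (length w) × ∃ λ n → n < suc (length w) × w ≡ take d w ^ (2 + n)
  properPower-bounded w ([] , n , _ , w≡[]ⁿ) = 0 , s≤s z≤n , 0 , s≤s z≤n , trans w≡[]ⁿ ([]^ n)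
  properPower-bounded _ ((b ∷ v) , suc (suc n) , _ , refl) =
    length (b ∷ v) , s≤s (length-++-≤ˡ (b ∷ v)) ,
    n , s≤s (≤-trans (m≤n+m n 2) (exponent≤length-^ b v (2 + n))) ,
    cong (_^ (2 + n)) (sym (take-length-++ (b ∷ v) _))
  properPower-bounded _ ((_ ∷ _) , 1 , s≤s () , _)

  properPower? : (w : Word k) → Dec (ProperPower w)
  properPower? w = map′ (λ (d , _ , n , _ , eq) → take d w , 2 + n , s≤s (s≤s z≤n) , eq)
    (properPower-bounded w)
    (anyUpTo? (λ d → anyUpTo? (λ n → ≡-dec _≟ᶠ_ w (take d w ^ (2 + n))) L) L)
    where L = suc (length w)

  primitive? : (w : Word k) → Dec (Primitive w)
  primitive? []      = no λ (w≢[] , _) → w≢[] refl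
  primitive? (a ∷ w) with properPower? (a ∷ w)
  ... | yes pp = no λ (_ , ¬pp) → ¬pp pp
  ... | no ¬pp = yes ((λ ()) , ¬pp)

  primitive-root : (w : Word k) → w ≢ [] → Σ (Word k) λ p → Σ ℕ λ m → Primitive p × (w ≡ p ^ suc m)
  primitive-root w w≢[] = root w w≢[] (<-wellFounded (length w))
    where
    root : (w : Word k) → w ≢ [] → Acc _<_ (length w) →
           Σ (Word k) λ p → Σ ℕ λ m → Primitive p × (w ≡ p ^ suc m)
    root w w≢[] (acc shorter) with properPower? w
    ... | no ¬pp = w , 0 , (w≢[] , ¬pp) , sym (++-identityʳ w)
    ... | yes ([] , n , _ , w≡[]ⁿ) = ⊥-elim (w≢[] (trans w≡[]ⁿ ([]^ n)))
    ... | yes ((_ ∷ _) , 1 , s≤s () , _)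
    ... | yes ((b ∷ v) , suc (suc n) , _ , w≡vⁿ)
        with root (b ∷ v) (λ ())
               (shorter (subst (λ x → length (b ∷ v) < length x) (sym w≡vⁿ) (length-<-^ b v n)))
    ...   | p , m , p-prim , v≡pᵐ = p , m + suc n * suc m , p-prim , (begin
            w                          ≡⟨ w≡vⁿ ⟩
            (b ∷ v) ^ (2 + n)          ≡⟨ cong (_^ (2 + n)) v≡pᵐ ⟩
            (p ^ suc m) ^ (2 + n)      ≡⟨ ^-* p (suc m) (2 + n) ⟩
            p ^ ((2 + n) * suc m)      ∎)
      where open ≡-Reasoning

  ++-∷≢[] : (x y : Word k) (a : Fin k) → x ++ (a ∷ y) ≢ []
  ++-∷≢[] x y a eq with ++-conicalʳ x (a ∷ y) eq
  ... | ()

  letter-in-++ : (x y p z : Word k) (a : Fin k) → x ++ (a ∷ y) ≡ p ++ z →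
    (Σ (Word k) λ t → (p ≡ x ++ (a ∷ t)) × (y ≡ t ++ z)) ⊎
    (Σ (Word k) λ t → (x ≡ p ++ t) × (t ++ (a ∷ y) ≡ z))
  letter-in-++ x       y []      z a eq   = inj₂ (x , refl , eq)
  letter-in-++ []      y (_ ∷ p) z a refl = inj₁ (p , refl , refl)
  letter-in-++ (b ∷ x) y (_ ∷ p) z a eq with ∷-injective eq
  ... | refl , eq′ with letter-in-++ x y p z a eq′
  ...   | inj₁ (t , p≡ , y≡) = inj₁ (t , cong (b ∷_) p≡ , y≡)
  ...   | inj₂ (t , x≡ , z≡) = inj₂ (t , cong (b ∷_) x≡ , z≡)

  letter-in-^ : (m : ℕ) (p x y : Word k) (a : Fin k) → x ++ (a ∷ y) ≡ p ^ m →
    Σ (Word k) λ u₁ → Σ (Word k) λ u₂ → Σ ℕ λ q → Σ ℕ λ s →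
      (p ≡ u₁ ++ (a ∷ u₂)) × (x ++ y ≡ p ^ q ++ (u₁ ++ (u₂ ++ p ^ s))) × (suc (q + s) ≡ m)
  letter-in-^ zero    p x y a eq = ⊥-elim (++-∷≢[] x y a eq)
  letter-in-^ (suc m) p x y a eq with letter-in-++ x y p (p ^ m) a eq
  ... | inj₁ (t , p≡ , y≡) = x , t , 0 , m , p≡ , cong (x ++_) y≡ , refl
  ... | inj₂ (t , x≡ , t-in-pᵐ) with letter-in-^ m p t y a t-in-pᵐ
  ...   | u₁ , u₂ , q , s , p≡ , ty≡ , q+s≡ = u₁ , u₂ , suc q , s , p≡ , (begin
          x ++ y                                 ≡⟨ cong (_++ y) x≡ ⟩
          (p ++ t) ++ y                          ≡⟨ ++-assoc p t y ⟩
          p ++ (t ++ y)                          ≡⟨ cong (p ++_) ty≡ ⟩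
          p ++ (p ^ q ++ (u₁ ++ (u₂ ++ p ^ s)))  ≡⟨ sym (++-assoc p (p ^ q) _) ⟩
          p ^ suc q ++ (u₁ ++ (u₂ ++ p ^ s))     ∎) , cong suc q+s≡
    where open ≡-Reasoning

  nonprimitive-insertion⇒shortOfPower : (x y : Word k) (a : Fin k) →
    ¬ Primitive (x ++ (a ∷ y)) → ShortOfPower (x ++ y)
  nonprimitive-insertion⇒shortOfPower x y a ¬prim with primitive-root (x ++ (a ∷ y)) (++-∷≢[] x y a)
  ... | p , zero , p-prim , xay≡p¹ =
          ⊥-elim (¬prim (subst Primitive (sym (trans xay≡p¹ (++-identityʳ p))) p-prim))
  ... | p , suc m , p-prim , xay≡pᵐ with letter-in-^ (suc (suc m)) p x y a xay≡pᵐ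
  ...   | u₁ , u₂ , q , s , refl , xy≡ , q+s≡ =
          u₁ , u₂ , a , q , s , p-prim , subst (1 ≤_) (sym (suc-injective q+s≡)) (s≤s z≤n) , xy≡

  shortOfPower⇒¬InsRobust : (w : Word k) → ShortOfPower w → ¬ InsRobust w
  shortOfPower⇒¬InsRobust _ (u₁ , u₂ , c , r , s , _ , 1≤r+s , refl) (_ , robust) =
    proj₂ (robust (length A) A≤w c)
          (u , r + suc s , subst (2 ≤_) (sym (+-suc r s)) (s≤s 1≤r+s) , inserted)
    where
    open ≡-Reasoning
    u = u₁ ++ (c ∷ u₂)
    A = u ^ r ++ u₁
    B = u₂ ++ u ^ s
    A≤w : length A ≤ length (u ^ r ++ (u₁ ++ B))
    A≤w = ≤-trans (length-++-≤ˡ A) (≤-reflexive (cong length (++-assoc (u ^ r) u₁ B)))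
    inserted : insertAt (u ^ r ++ (u₁ ++ B)) (length A) c ≡ u ^ (r + suc s)
    inserted = begin
      insertAt (u ^ r ++ (u₁ ++ B)) (length A) c  ≡⟨ cong (λ w → insertAt w (length A) c) (sym (++-assoc (u ^ r) u₁ B)) ⟩
      insertAt (A ++ B) (length A) c              ≡⟨ insertAt-++ A B c ⟩
      A ++ (c ∷ B)                                ≡⟨ ++-assoc (u ^ r) u₁ (c ∷ B) ⟩
      u ^ r ++ (u₁ ++ (c ∷ B))                    ≡⟨ cong (u ^ r ++_) (sym (++-assoc u₁ (c ∷ u₂) (u ^ s))) ⟩
      u ^ r ++ u ^ suc s                          ≡⟨ sym (^-+ u r (suc s)) ⟩
      u ^ (r + suc s)                             ∎

  nonprimitive-insertion : (w : Word k) → Primitive w → ¬ InsRobust w →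
    Σ ℕ λ i → Σ (Fin k) λ a → ¬ Primitive (insertAt w i a)
  nonprimitive-insertion w w-prim ¬robust
    with anyUpTo? (λ i → any? λ a → ¬? (primitive? (insertAt w i a))) (suc (length w))
  ... | yes (i , _ , a , ¬prim) = i , a , ¬prim
  ... | no none = ⊥-elim (¬robust (w-prim , λ i i≤w a →
          decidable-stable (primitive? _) λ ¬prim → none (i , s≤s i≤w , a , ¬prim)))

  ¬InsRobust⇒shortOfPower : (w : Word k) → Primitive w → ¬ InsRobust w → ShortOfPower w
  ¬InsRobust⇒shortOfPower w w-prim ¬robust =
    let i , a , ¬prim = nonprimitive-insertion w w-prim ¬robust
    in subst ShortOfPower (take++drop≡id i w)
         (nonprimitive-insertion⇒shortOfPower (take i w) (drop i w) a ¬prim)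

theorem4 : (k : ℕ) → 2 ≤ k → (w : Word k) → Primitive w →
    (¬ InsRobust w) ⇔
    (Σ (Word k) λ u₁ → Σ (Word k) λ u₂ → Σ (Fin k) λ c → Σ ℕ λ r → Σ ℕ λ s →
      Primitive (u₁ ++ (c ∷ u₂)) × (1 ≤ r + s) ×
      (w ≡ ((u₁ ++ (c ∷ u₂)) ^ r) ++ (u₁ ++ (u₂ ++ ((u₁ ++ (c ∷ u₂)) ^ s)))))
theorem4 k _ w w-prim = mk⇔ (¬InsRobust⇒shortOfPower w w-prim) (shortOfPower⇒¬InsRobust w)
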